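{- Let $n,d$ be positive integers with $n\geq2d$, and let $G$ be an induced subgraph of the Johnson graph $J(n,d)$ with $r$ vertices. (i) If $r=\binom{n-1}{d}+1$, then $\Delta(G)\geq n-d$. (ii) If $r=\binom{n-1}{d-1}+1$, then $\Delta(G)\geq d$.
   Context: The Johnson graph $J(n,d)$ has as vertices the $d$-element subsets of $\{1,\dots,n\}$, two being adjacent iff their intersection has size $d-1$. $\Delta(G)$ denotes the maximum degree of a graph $G$. -}

module Defs where

open import Data.Nat using (ℕ; _∸_; _⊔_; _≟_)
open import Data.Bool using (Bool)
open import Data.Fin.Subset using (Subset; _∩_; ∣_∣)
open import Data.List using (List; []; _∷_; filter; length; map; foldr)
open import Relation.Nullary using (Dec)
open import Relation.Binary.PropositionalEquality using (_≡_)

JohnsonAdj : ∀ {n} (d : ℕ) → Subset n → Subset n → Set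
JohnsonAdj d A B = ∣ A ∩ B ∣ ≡ d ∸ 1

johnsonAdj? : ∀ {n} (d : ℕ) (A B : Subset n) → Dec (JohnsonAdj d A B)
johnsonAdj? d A B = ∣ A ∩ B ∣ ≟ d ∸ 1

-- Degree of vertex A in the induced subgraph of J(n,d) on the vertex list S
-- (S is assumed duplicate-free): number of vertices of S adjacent to A.
degree : ∀ {n} (d : ℕ) (S : List (Subset n)) → Subset n → ℕ
degree d S A = length (filter (johnsonAdj? d A) S)

maxDegree : ∀ {n} (d : ℕ) (S : List (Subset n)) → ℕ
maxDegree d S = foldr _⊔_ 0 (map (degree d S) S)

{-# OPTIONS --safe #-}
module Submission where

-- Let k = d - 1 and, for a k-subset t of [n], let c(t) be the number of members of S containing t.
-- As c(t) is a natural number, (c(t) - 1)(c(t) - 2) ≥ 0, i.e. 3 c(t) ≤ 2 + c(t)²; summing over all t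
-- and double counting gives 3 Σ_A C(|A|,k) ≤ 2 C(n,k) + Σ_{A,B} C(|A ∩ B|,k). For d-sets A, B the
-- term C(|A ∩ B|,k) is d if A = B, 1 if A ~ B and 0 otherwise, whence 2 d |S| ≤ 2 C(n,k) + |S| Δ.
-- If Δ < d this says (d + 1) |S| ≤ 2 C(n,k) = 2 C(n-1,k) + 2 C(n-1,k-1), which fails for
-- |S| = C(n-1,k) + 1 because 2 C(n-1,k-1) ≤ k C(n-1,k) when d < n. This is (ii); complementation
-- is an isomorphism J(n,d) ≅ J(n,n-d), and turns (i) into (ii) for n - d.

open import Defs
open import Data.Bool using (true; false; if_then_else_) renaming (_≟_ to _≟ᵇ_)
open import Data.Fin.Subset using (Subset; ∣_∣; _∩_; _⊆_; ∁; inside; outside; ⊤)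
open import Data.Fin.Subset.Properties
  using (_⊆?_; ⊆⊤; ∣⊤∣≡n; ⊆-trans; ⊆-antisym; ⊆-reflexive; p∩q⊆p; p∩q⊆q; x∈p∩q⁺; ∩-idem;
         ∣p∩q∣≤∣p∣; ∣p∩q∣≤∣q∣; ∣∁p∣≡n∸∣p∣; ∁p⊆∁q⇒p⊇q)
open import Data.List using (List; []; _∷_; [_]; _++_; map; length; filter; foldr)
open import Data.List.Properties using (map-cong; map-cong-local; map-∘; map-++; length-map)
open import Data.List.Relation.Unary.All as All using (All; []; _∷_)
import Data.List.Relation.Unary.All.Properties as All
open import Data.List.Relation.Unary.AllPairs using ([]; _∷_)
open import Data.List.Relation.Unary.Unique.Propositional using (Unique)
import Data.List.Relation.Unary.Unique.Propositional.Properties as Unique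
open import Data.Nat
open import Data.Nat.Combinatorics using (_C_; nCk+nC[k+1]≡[n+1]C[k+1]; nCk≡nC[n∸k]; nC1≡n; nCn≡1; k>n⇒nCk≡0)
open import Data.Nat.ListAction using (sum)
open import Data.Nat.ListAction.Properties using (sum-++)
open import Data.Nat.Properties
open import Algebra.Properties.CommutativeSemigroup +-commutativeSemigroup using (interchange)
open import Data.Nat.Tactic.RingSolver using (solve-∀)
open import Data.Product using (_×_; _,_)
open import Data.Sum using (inj₁; inj₂)
open import Data.Vec using ([]; _∷_)
open import Data.Vec.Properties using (≡-dec)
open import Function using (_∘_; _⇔_; mk⇔; Equivalence)
open import Relation.Binary.Definitions using (DecidableEquality)
open import Relation.Binary.PropositionalEquality
  using (_≡_; refl; sym; trans; cong; cong₂; subst; module ≡-Reasoning)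
open import Relation.Nullary using (Dec; does; yes; no; ¬_; _because_; _×-dec_; contradiction)
open import Relation.Nullary.Decidable using (dec-true; dec-false)
open import Relation.Unary using (Decidable)

private variable
  A B P Q : Set

[1+n]Cn≡1+n : ∀ n → suc n C n ≡ suc n
[1+n]Cn≡1+n n = begin
  suc n C n            ≡⟨ nCk≡nC[n∸k] (n≤1+n n) ⟩
  suc n C (suc n ∸ n)  ≡⟨ cong (suc n C_) (m+n∸n≡m 1 n) ⟩
  suc n C 1            ≡⟨ nC1≡n (suc n) ⟩
  suc n                ∎
  where open ≡-Reasoning

[1+k]*nC[1+k]+k*nCk≡n*nCk : ∀ n k → suc k * (n C suc k) + k * (n C k) ≡ n * (n C k)
[1+k]*nC[1+k]+k*nCk≡n*nCk zero    zero    = refl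
[1+k]*nC[1+k]+k*nCk≡n*nCk zero    (suc k) = cong₂ _+_ (*-zeroʳ (2 + k)) (*-zeroʳ (suc k))
[1+k]*nC[1+k]+k*nCk≡n*nCk (suc n) zero    = begin
  1 * (suc n C 1) + 0  ≡⟨ +-identityʳ _ ⟩
  1 * (suc n C 1)      ≡⟨ *-identityˡ _ ⟩
  suc n C 1            ≡⟨ nC1≡n (suc n) ⟩
  suc n                ≡⟨ *-identityʳ (suc n) ⟨
  suc n * 1            ∎
  where open ≡-Reasoning
[1+k]*nC[1+k]+k*nCk≡n*nCk (suc n) (suc k) = begin
  (2 + k) * (suc n C (2 + k)) + suc k * (suc n C suc k)
    ≡⟨ cong₂ (λ x y → (2 + k) * x + suc k * y) (pascal (suc k)) (pascal k) ⟨
  (2 + k) * (b + c) + suc k * (a + b)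
    ≡⟨ regroup k a b c ⟩
  ((2 + k) * c + suc k * b) + (suc k * b + k * a) + (a + b)
    ≡⟨ cong₂ (λ x y → x + y + (a + b)) ([1+k]*nC[1+k]+k*nCk≡n*nCk n (suc k)) ([1+k]*nC[1+k]+k*nCk≡n*nCk n k) ⟩
  n * b + n * a + (a + b)
    ≡⟨ cong (_+ (a + b)) (trans (+-comm (n * b) (n * a)) (sym (*-distribˡ-+ n a b))) ⟩
  n * (a + b) + (a + b)
    ≡⟨ +-comm (n * (a + b)) (a + b) ⟩
  suc n * (a + b)
    ≡⟨ cong (suc n *_) (pascal k) ⟩
  suc n * (suc n C suc k)
    ∎
  where
  open ≡-Reasoning
  pascal = nCk+nC[k+1]≡[n+1]C[k+1] n
  a = n C k
  b = n C suc k
  c = n C (2 + k)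
  regroup : ∀ k a b c → (2 + k) * (b + c) + suc k * (a + b) ≡ ((2 + k) * c + suc k * b) + (suc k * b + k * a) + (a + b)
  regroup = solve-∀

2*nCk≤[1+k]*nC[1+k] : ∀ {n k} → 2 + k ≤ n → 2 * (n C k) ≤ suc k * (n C suc k)
2*nCk≤[1+k]*nC[1+k] {n} {k} 2+k≤n = +-cancelʳ-≤ (k * (n C k)) _ _ (begin
  2 * (n C k) + k * (n C k)                ≡⟨ *-distribʳ-+ (n C k) 2 k ⟨
  (2 + k) * (n C k)                        ≤⟨ *-monoˡ-≤ (n C k) 2+k≤n ⟩
  n * (n C k)                              ≡⟨ [1+k]*nC[1+k]+k*nCk≡n*nCk n k ⟨
  suc k * (n C suc k) + k * (n C k)        ∎)
  where open ≤-Reasoning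

2*[1+n]Ck<[nCk+1]*[2+k] : ∀ {n k} → suc k ≤ n → 2 * (suc n C k) < (n C k + 1) * (2 + k)
2*[1+n]Ck<[nCk+1]*[2+k] {n} {zero}  _    = s≤s (s≤s (s≤s z≤n))
2*[1+n]Ck<[nCk+1]*[2+k] {n} {suc k} 2+k≤n = begin-strict
  2 * (suc n C suc k)       ≡⟨ cong (2 *_) (nCk+nC[k+1]≡[n+1]C[k+1] n k) ⟨
  2 * (a + b)               ≡⟨ *-distribˡ-+ 2 a b ⟩
  2 * a + 2 * b             ≤⟨ +-monoˡ-≤ (2 * b) (2*nCk≤[1+k]*nC[1+k] 2+k≤n) ⟩
  suc k * b + 2 * b         ≡⟨ +-comm (suc k * b) (2 * b) ⟩
  2 * b + suc k * b         ≡⟨ *-distribʳ-+ b 2 (suc k) ⟨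
  (3 + k) * b               <⟨ *-monoʳ-< (3 + k) (m<m+n b z<s) ⟩
  (3 + k) * (b + 1)         ≡⟨ *-comm (3 + k) (b + 1) ⟩
  (b + 1) * (3 + k)         ∎
  where
  open ≤-Reasoning
  a = n C k
  b = n C suc k

∑ : List A → (A → ℕ) → ℕ
∑ xs f = sum (map f xs)

syntax ∑ xs (λ x → e) = ∑[ x ∈ xs ] e

module _ {f g : A → ℕ} where

  ∑-cong : (∀ x → f x ≡ g x) → ∀ xs → ∑ xs f ≡ ∑ xs g
  ∑-cong f≗g xs = cong sum (map-cong f≗g xs)

  ∑-cong-local : ∀ {xs} → All (λ x → f x ≡ g x) xs → ∑ xs f ≡ ∑ xs g
  ∑-cong-local = cong sum ∘ map-cong-local

  ∑-mono-≤-local : ∀ {xs} → All (λ x → f x ≤ g x) xs → ∑ xs f ≤ ∑ xs g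
  ∑-mono-≤-local []       = z≤n
  ∑-mono-≤-local (p ∷ ps) = +-mono-≤ p (∑-mono-≤-local ps)

  ∑-mono-≤ : (∀ x → f x ≤ g x) → ∀ xs → ∑ xs f ≤ ∑ xs g
  ∑-mono-≤ f≤g []       = z≤n
  ∑-mono-≤ f≤g (x ∷ xs) = +-mono-≤ (f≤g x) (∑-mono-≤ f≤g xs)

  ∑-distrib-+ : ∀ xs → ∑[ x ∈ xs ] (f x + g x) ≡ ∑ xs f + ∑ xs g
  ∑-distrib-+ []       = refl
  ∑-distrib-+ (x ∷ xs) = trans (cong (f x + g x +_) (∑-distrib-+ xs)) (interchange (f x) (g x) (∑ xs f) (∑ xs g))

∑-*ˡ : ∀ c (f : A → ℕ) xs → ∑[ x ∈ xs ] (c * f x) ≡ c * ∑ xs f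
∑-*ˡ c f []       = sym (*-zeroʳ c)
∑-*ˡ c f (x ∷ xs) = trans (cong (c * f x +_) (∑-*ˡ c f xs)) (sym (*-distribˡ-+ c (f x) (∑ xs f)))

∑-const : ∀ c (xs : List A) → ∑[ _ ∈ xs ] c ≡ length xs * c
∑-const c []       = refl
∑-const c (x ∷ xs) = cong (c +_) (∑-const c xs)

∑-zero : ∀ (xs : List A) → ∑[ _ ∈ xs ] 0 ≡ 0
∑-zero xs = trans (∑-const 0 xs) (*-zeroʳ (length xs))

∑-++ : ∀ (f : A → ℕ) xs ys → ∑ (xs ++ ys) f ≡ ∑ xs f + ∑ ys f
∑-++ f xs ys = trans (cong sum (map-++ f xs ys)) (sum-++ (map f xs) (map f ys))

∑-map : ∀ (f : B → ℕ) (g : A → B) xs → ∑ (map g xs) f ≡ ∑[ x ∈ xs ] f (g x)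
∑-map f g xs = cong sum (sym (map-∘ xs))

∑-comm : ∀ (f : A → B → ℕ) xs ys → ∑[ x ∈ xs ] ∑[ y ∈ ys ] f x y ≡ ∑[ y ∈ ys ] ∑[ x ∈ xs ] f x y
∑-comm f []       ys = sym (∑-zero ys)
∑-comm f (x ∷ xs) ys = begin
  ∑[ y ∈ ys ] f x y + ∑[ x ∈ xs ] ∑[ y ∈ ys ] f x y  ≡⟨ cong (∑[ y ∈ ys ] f x y +_) (∑-comm f xs ys) ⟩
  ∑[ y ∈ ys ] f x y + ∑[ y ∈ ys ] ∑[ x ∈ xs ] f x y  ≡⟨ ∑-distrib-+ ys ⟨
  ∑[ y ∈ ys ] (f x y + ∑[ x ∈ xs ] f x y)            ∎
  where open ≡-Reasoning

∑*∑ : ∀ (f g : A → ℕ) xs → ∑ xs f * ∑ xs g ≡ ∑[ x ∈ xs ] ∑[ y ∈ xs ] (f x * g y)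
∑*∑ f g xs = begin
  ∑ xs f * ∑ xs g                      ≡⟨ *-comm (∑ xs f) (∑ xs g) ⟩
  ∑ xs g * ∑ xs f                      ≡⟨ ∑-*ˡ (∑ xs g) f xs ⟨
  ∑[ x ∈ xs ] (∑ xs g * f x)           ≡⟨ ∑-cong (λ x → trans (*-comm (∑ xs g) (f x)) (sym (∑-*ˡ (f x) g xs))) xs ⟩
  ∑[ x ∈ xs ] ∑[ y ∈ xs ] (f x * g y)  ∎
  where open ≡-Reasoning

sum≤length*max : ∀ ns → sum ns ≤ length ns * foldr _⊔_ 0 ns
sum≤length*max []       = z≤n
sum≤length*max (n ∷ ns) = +-mono-≤ (m≤m⊔n n (foldr _⊔_ 0 ns))
  (≤-trans (sum≤length*max ns) (*-monoʳ-≤ (length ns) (m≤n⊔m n (foldr _⊔_ 0 ns))))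

𝟙 : Dec P → ℕ
𝟙 P? = if does P? then 1 else 0

𝟙-yes : (P? : Dec P) → P → 𝟙 P? ≡ 1
𝟙-yes P? p = cong (λ b → if b then 1 else 0) (dec-true P? p)

𝟙-no : (P? : Dec P) → ¬ P → 𝟙 P? ≡ 0
𝟙-no P? ¬p = cong (λ b → if b then 1 else 0) (dec-false P? ¬p)

𝟙-cong : P ⇔ Q → (P? : Dec P) (Q? : Dec Q) → 𝟙 P? ≡ 𝟙 Q?
𝟙-cong P⇔Q (yes p)  Q? = sym (𝟙-yes Q? (Equivalence.to P⇔Q p))
𝟙-cong P⇔Q (no ¬p) Q? = sym (𝟙-no Q? (¬p ∘ Equivalence.from P⇔Q))

𝟙-×-dec : (P? : Dec P) (Q? : Dec Q) → 𝟙 (P? ×-dec Q?) ≡ 𝟙 P? * 𝟙 Q?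
𝟙-×-dec (true because _)  (true because _)  = refl
𝟙-×-dec (true because _)  (false because _) = refl
𝟙-×-dec (false because _) _                 = refl

∑𝟙≡length-filter : ∀ {P : A → Set} (P? : Decidable P) xs → ∑[ x ∈ xs ] 𝟙 (P? x) ≡ length (filter P? xs)
∑𝟙≡length-filter P? []       = refl
∑𝟙≡length-filter P? (x ∷ xs) with does (P? x)
... | true  = cong suc (∑𝟙≡length-filter P? xs)
... | false = ∑𝟙≡length-filter P? xs

∑𝟙[≟]-unique : (_≟_ : DecidableEquality A) (x : A) {xs : List A} → Unique xs → ∑[ y ∈ xs ] 𝟙 (x ≟ y) ≤ 1
∑𝟙[≟]-unique _≟_ x []                  = z≤n
∑𝟙[≟]-unique _≟_ x {y ∷ xs} (y∉xs ∷ u) with x ≟ y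
... | yes refl = ≤-reflexive (cong suc (trans (∑-cong-local (All.map (𝟙-no (x ≟ _)) y∉xs)) (∑-zero xs)))
... | no  _    = ∑𝟙[≟]-unique _≟_ x u

subsetsOfSize : (n k : ℕ) → List (Subset n)
subsetsOfSize zero    zero    = [ [] ]
subsetsOfSize zero    (suc k) = []
subsetsOfSize (suc n) zero    = map (outside ∷_) (subsetsOfSize n zero)
subsetsOfSize (suc n) (suc k) = map (outside ∷_) (subsetsOfSize n (suc k)) ++ map (inside ∷_) (subsetsOfSize n k)

count-subsetsOfSize-⊆ : ∀ {n} (k : ℕ) (p : Subset n) → ∑[ t ∈ subsetsOfSize n k ] 𝟙 (t ⊆? p) ≡ ∣ p ∣ C k
count-subsetsOfSize-⊆ zero    []      = refl
count-subsetsOfSize-⊆ (suc k) []      = refl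
count-subsetsOfSize-⊆ {suc n} zero (x ∷ p) =
  trans (∑-map _ (outside ∷_) (subsetsOfSize n zero)) (count-subsetsOfSize-⊆ zero p)
count-subsetsOfSize-⊆ {suc n} (suc k) (x ∷ p) = begin
  ∑[ t ∈ map (outside ∷_) ts₁ ++ map (inside ∷_) ts₀ ] 𝟙 (t ⊆? x ∷ p)
    ≡⟨ ∑-++ _ (map (outside ∷_) ts₁) (map (inside ∷_) ts₀) ⟩
  ∑[ t ∈ map (outside ∷_) ts₁ ] 𝟙 (t ⊆? x ∷ p) + ∑[ t ∈ map (inside ∷_) ts₀ ] 𝟙 (t ⊆? x ∷ p)
    ≡⟨ cong₂ _+_ (trans (∑-map _ (outside ∷_) ts₁) (count-subsetsOfSize-⊆ (suc k) p)) (∑-map _ (inside ∷_) ts₀) ⟩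
  ∣ p ∣ C suc k + ∑[ t ∈ ts₀ ] 𝟙 (inside ∷ t ⊆? x ∷ p)
    ≡⟨ case-head x ⟩
  ∣ x ∷ p ∣ C suc k ∎
  where
  open ≡-Reasoning
  ts₁ = subsetsOfSize n (suc k)
  ts₀ = subsetsOfSize n k
  case-head : ∀ x → ∣ p ∣ C suc k + ∑[ t ∈ ts₀ ] 𝟙 (inside ∷ t ⊆? x ∷ p) ≡ ∣ x ∷ p ∣ C suc k
  case-head true  = trans (cong (∣ p ∣ C suc k +_) (count-subsetsOfSize-⊆ k p))
                          (trans (+-comm (∣ p ∣ C suc k) (∣ p ∣ C k)) (nCk+nC[k+1]≡[n+1]C[k+1] ∣ p ∣ k))
  case-head false = trans (cong (∣ p ∣ C suc k +_) (∑-zero ts₀)) (+-identityʳ (∣ p ∣ C suc k))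

length-subsetsOfSize : ∀ n k → length (subsetsOfSize n k) ≡ n C k
length-subsetsOfSize n k = begin
  length (subsetsOfSize n k)              ≡⟨ *-identityʳ (length (subsetsOfSize n k)) ⟨
  length (subsetsOfSize n k) * 1          ≡⟨ ∑-const 1 (subsetsOfSize n k) ⟨
  ∑[ t ∈ subsetsOfSize n k ] 1            ≡⟨ ∑-cong (λ t → sym (𝟙-yes (t ⊆? ⊤) ⊆⊤)) (subsetsOfSize n k) ⟩
  ∑[ t ∈ subsetsOfSize n k ] 𝟙 (t ⊆? ⊤)  ≡⟨ count-subsetsOfSize-⊆ k (⊤ {n}) ⟩
  ∣ ⊤ {n} ∣ C k                           ≡⟨ cong (_C k) (∣⊤∣≡n n) ⟩
  n C k                                   ∎
  where open ≡-Reasoning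

⊆×⊆⇔⊆∩ : ∀ {n} {t p q : Subset n} → (t ⊆ p × t ⊆ q) ⇔ t ⊆ p ∩ q
⊆×⊆⇔⊆∩ {t = t} {p} {q} = mk⇔ to from
  where
  to : t ⊆ p × t ⊆ q → t ⊆ p ∩ q
  to (t⊆p , t⊆q) x∈t = x∈p∩q⁺ (t⊆p x∈t , t⊆q x∈t)
  from : t ⊆ p ∩ q → t ⊆ p × t ⊆ q
  from t⊆p∩q = ⊆-trans t⊆p∩q (p∩q⊆p p q) , ⊆-trans t⊆p∩q (p∩q⊆q p q)

3*x≤2+x*x : ∀ x → 3 * x ≤ 2 + x * x
3*x≤2+x*x 0 = z≤n
3*x≤2+x*x 1 = ≤-refl
3*x≤2+x*x 2 = ≤-refl
3*x≤2+x*x x@(suc (suc (suc m))) = ≤-trans (*-monoˡ-≤ x (s≤s (s≤s (s≤s (z≤n {m}))))) (m≤n+m (x * x) 2)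

module _ {n} (k : ℕ) (S : List (Subset n)) where

  private
    ts = subsetsOfSize n k

  coverage : Subset n → ℕ
  coverage t = ∑[ a ∈ S ] 𝟙 (t ⊆? a)

  ∑-coverage : ∑[ t ∈ ts ] coverage t ≡ ∑[ a ∈ S ] (∣ a ∣ C k)
  ∑-coverage = trans (∑-comm (λ t a → 𝟙 (t ⊆? a)) ts S) (∑-cong (count-subsetsOfSize-⊆ k) S)

  ∑-coverage² : ∑[ t ∈ ts ] (coverage t * coverage t) ≡ ∑[ a ∈ S ] ∑[ b ∈ S ] (∣ a ∩ b ∣ C k)
  ∑-coverage² = begin
    ∑[ t ∈ ts ] (coverage t * coverage t)
      ≡⟨ ∑-cong (λ t → ∑*∑ (λ a → 𝟙 (t ⊆? a)) (λ b → 𝟙 (t ⊆? b)) S) ts ⟩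
    ∑[ t ∈ ts ] ∑[ a ∈ S ] ∑[ b ∈ S ] (𝟙 (t ⊆? a) * 𝟙 (t ⊆? b))
      ≡⟨ ∑-cong (λ t → ∑-cong (λ a → ∑-cong (λ b → 𝟙[⊆]*𝟙[⊆] t a b) S) S) ts ⟩
    ∑[ t ∈ ts ] ∑[ a ∈ S ] ∑[ b ∈ S ] 𝟙 (t ⊆? a ∩ b)
      ≡⟨ ∑-comm (λ t a → ∑[ b ∈ S ] 𝟙 (t ⊆? a ∩ b)) ts S ⟩
    ∑[ a ∈ S ] ∑[ t ∈ ts ] ∑[ b ∈ S ] 𝟙 (t ⊆? a ∩ b)
      ≡⟨ ∑-cong (λ a → ∑-comm (λ t b → 𝟙 (t ⊆? a ∩ b)) ts S) S ⟩
    ∑[ a ∈ S ] ∑[ b ∈ S ] ∑[ t ∈ ts ] 𝟙 (t ⊆? a ∩ b)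
      ≡⟨ ∑-cong (λ a → ∑-cong (λ b → count-subsetsOfSize-⊆ k (a ∩ b)) S) S ⟩
    ∑[ a ∈ S ] ∑[ b ∈ S ] (∣ a ∩ b ∣ C k)
      ∎
    where
    open ≡-Reasoning
    𝟙[⊆]*𝟙[⊆] : ∀ t a b → 𝟙 (t ⊆? a) * 𝟙 (t ⊆? b) ≡ 𝟙 (t ⊆? a ∩ b)
    𝟙[⊆]*𝟙[⊆] t a b = trans (sym (𝟙-×-dec (t ⊆? a) (t ⊆? b))) (𝟙-cong ⊆×⊆⇔⊆∩ (t ⊆? a ×-dec t ⊆? b) (t ⊆? a ∩ b))

  double-counting : 3 * ∑[ a ∈ S ] (∣ a ∣ C k) ≤ 2 * (n C k) + ∑[ a ∈ S ] ∑[ b ∈ S ] (∣ a ∩ b ∣ C k)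
  double-counting = begin
    3 * ∑[ a ∈ S ] (∣ a ∣ C k)                             ≡⟨ cong (3 *_) ∑-coverage ⟨
    3 * ∑[ t ∈ ts ] coverage t                              ≡⟨ ∑-*ˡ 3 coverage ts ⟨
    ∑[ t ∈ ts ] (3 * coverage t)                            ≤⟨ ∑-mono-≤ (λ t → 3*x≤2+x*x (coverage t)) ts ⟩
    ∑[ t ∈ ts ] (2 + coverage t * coverage t)               ≡⟨ ∑-distrib-+ ts ⟩
    ∑[ t ∈ ts ] 2 + ∑[ t ∈ ts ] (coverage t * coverage t)   ≡⟨ cong₂ _+_ ∑2≡[nCk]*2 ∑-coverage² ⟩
    (n C k) * 2 + pairs                                     ≡⟨ cong (_+ pairs) (*-comm (n C k) 2) ⟩
    2 * (n C k) + pairs                                     ∎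
    where
    open ≤-Reasoning
    pairs = ∑[ a ∈ S ] ∑[ b ∈ S ] (∣ a ∩ b ∣ C k)
    ∑2≡[nCk]*2 : ∑[ t ∈ ts ] 2 ≡ (n C k) * 2
    ∑2≡[nCk]*2 = trans (∑-const 2 ts) (cong (_* 2) (length-subsetsOfSize n k))

_≟ₛ_ : ∀ {n} → DecidableEquality (Subset n)
_≟ₛ_ = ≡-dec _≟ᵇ_

∣p∩q∣≡∣p∣≡∣q∣⇒p≡q : ∀ {n} {p q : Subset n} → ∣ p ∩ q ∣ ≡ ∣ p ∣ → ∣ p ∣ ≡ ∣ q ∣ → p ≡ q
∣p∩q∣≡∣p∣≡∣q∣⇒p≡q {p = []}        {[]}        _ _ = refl
∣p∩q∣≡∣p∣≡∣q∣⇒p≡q {p = true ∷ p}  {true ∷ q}  e₁ e₂ =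
  cong (true ∷_) (∣p∩q∣≡∣p∣≡∣q∣⇒p≡q (suc-injective e₁) (suc-injective e₂))
∣p∩q∣≡∣p∣≡∣q∣⇒p≡q {p = false ∷ p} {false ∷ q} e₁ e₂ = cong (false ∷_) (∣p∩q∣≡∣p∣≡∣q∣⇒p≡q e₁ e₂)
∣p∩q∣≡∣p∣≡∣q∣⇒p≡q {p = true ∷ p}  {false ∷ q} e₁ _  = contradiction (subst (_≤ ∣ p ∣) e₁ (∣p∩q∣≤∣p∣ p q)) 1+n≰n
∣p∩q∣≡∣p∣≡∣q∣⇒p≡q {p = false ∷ p} {true ∷ q}  e₁ e₂ = contradiction (subst (_≤ ∣ q ∣) (trans e₁ e₂) (∣p∩q∣≤∣q∣ p q)) 1+n≰n

m≤k⇒mCk≡𝟙[m≟k] : ∀ {m k} → m ≤ k → m C k ≡ 𝟙 (m ≟ k)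
m≤k⇒mCk≡𝟙[m≟k] {m} {k} m≤k with m≤n⇒m<n∨m≡n m≤k
... | inj₁ m<k  = trans (k>n⇒nCk≡0 m<k) (sym (𝟙-no (m ≟ k) (<⇒≢ m<k)))
... | inj₂ refl = trans (nCn≡1 m) (sym (𝟙-yes (m ≟ m) refl))

∣A∩B∣Ck≡adjacent+[1+k]*equal : ∀ {n} k {A B : Subset n} → ∣ A ∣ ≡ suc k → ∣ B ∣ ≡ suc k →
  ∣ A ∩ B ∣ C k ≡ 𝟙 (johnsonAdj? (suc k) A B) + suc k * 𝟙 (A ≟ₛ B)
∣A∩B∣Ck≡adjacent+[1+k]*equal k {A} {B} ∣A∣≡1+k ∣B∣≡1+k with A ≟ₛ B
... | yes refl = begin
  ∣ A ∩ A ∣ C k                                    ≡⟨ cong (_C k) ∣A∩A∣≡1+k ⟩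
  suc k C k                                        ≡⟨ [1+n]Cn≡1+n k ⟩
  suc k                                            ≡⟨ *-identityʳ (suc k) ⟨
  suc k * 1                                        ≡⟨ cong (_+ suc k * 1) (𝟙-no (johnsonAdj? (suc k) A A) (λ e → 1+n≢n (trans (sym ∣A∩A∣≡1+k) e))) ⟨
  𝟙 (johnsonAdj? (suc k) A A) + suc k * 1          ∎
  where
  open ≡-Reasoning
  ∣A∩A∣≡1+k : ∣ A ∩ A ∣ ≡ suc k
  ∣A∩A∣≡1+k = trans (cong ∣_∣ (∩-idem A)) ∣A∣≡1+k
... | no A≢B = begin
  ∣ A ∩ B ∣ C k                                    ≡⟨ m≤k⇒mCk≡𝟙[m≟k] ∣A∩B∣≤k ⟩
  𝟙 (johnsonAdj? (suc k) A B)                      ≡⟨ +-identityʳ _ ⟨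
  𝟙 (johnsonAdj? (suc k) A B) + 0                  ≡⟨ cong (𝟙 (johnsonAdj? (suc k) A B) +_) (*-zeroʳ (suc k)) ⟨
  𝟙 (johnsonAdj? (suc k) A B) + suc k * 0          ∎
  where
  open ≡-Reasoning
  ∣A∩B∣≤k : ∣ A ∩ B ∣ ≤ k
  ∣A∩B∣≤k = s≤s⁻¹ (≤∧≢⇒< (subst (∣ A ∩ B ∣ ≤_) ∣A∣≡1+k (∣p∩q∣≤∣p∣ A B))
                        (λ e → A≢B (∣p∩q∣≡∣p∣≡∣q∣⇒p≡q (trans e (sym ∣A∣≡1+k)) (trans ∣A∣≡1+k (sym ∣B∣≡1+k)))))

module _ {n} (k : ℕ) {S : List (Subset n)} (unique : Unique S) (sizes : All (λ A → ∣ A ∣ ≡ suc k) S) where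

  ∑∣A∩B∣Ck≤degree+1+k : ∀ {A} → ∣ A ∣ ≡ suc k → ∑[ B ∈ S ] (∣ A ∩ B ∣ C k) ≤ degree (suc k) S A + suc k
  ∑∣A∩B∣Ck≤degree+1+k {A} ∣A∣≡1+k = begin
    ∑[ B ∈ S ] (∣ A ∩ B ∣ C k)
      ≡⟨ ∑-cong-local (All.map (∣A∩B∣Ck≡adjacent+[1+k]*equal k {A} ∣A∣≡1+k) sizes) ⟩
    ∑[ B ∈ S ] (𝟙 (johnsonAdj? (suc k) A B) + suc k * 𝟙 (A ≟ₛ B))
      ≡⟨ ∑-distrib-+ S ⟩
    ∑[ B ∈ S ] 𝟙 (johnsonAdj? (suc k) A B) + ∑[ B ∈ S ] (suc k * 𝟙 (A ≟ₛ B))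
      ≡⟨ cong₂ _+_ (∑𝟙≡length-filter (johnsonAdj? (suc k) A) S) (∑-*ˡ (suc k) (λ B → 𝟙 (A ≟ₛ B)) S) ⟩
    degree (suc k) S A + suc k * ∑[ B ∈ S ] 𝟙 (A ≟ₛ B)
      ≤⟨ +-monoʳ-≤ (degree (suc k) S A) (*-monoʳ-≤ (suc k) (∑𝟙[≟]-unique _≟ₛ_ A unique)) ⟩
    degree (suc k) S A + suc k * 1
      ≡⟨ cong (degree (suc k) S A +_) (*-identityʳ (suc k)) ⟩
    degree (suc k) S A + suc k
      ∎
    where open ≤-Reasoning

  2*∣S∣*[1+k]≤2*nCk+∣S∣*maxDegree : 2 * (length S * suc k) ≤ 2 * (n C k) + length S * maxDegree (suc k) S
  2*∣S∣*[1+k]≤2*nCk+∣S∣*maxDegree = +-cancelʳ-≤ (s * suc k) _ _ (begin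
    2 * (s * suc k) + s * suc k                         ≡⟨ +-comm (2 * (s * suc k)) (s * suc k) ⟩
    3 * (s * suc k)                                     ≡⟨ cong (3 *_) ∑∣A∣Ck≡∣S∣*[1+k] ⟨
    3 * ∑[ A ∈ S ] (∣ A ∣ C k)                          ≤⟨ double-counting k S ⟩
    2 * (n C k) + ∑[ A ∈ S ] ∑[ B ∈ S ] (∣ A ∩ B ∣ C k) ≤⟨ +-monoʳ-≤ (2 * (n C k)) ∑∑∣A∩B∣Ck≤∣S∣*Δ+∣S∣*[1+k] ⟩
    2 * (n C k) + (s * Δ + s * suc k)                   ≡⟨ +-assoc (2 * (n C k)) (s * Δ) (s * suc k) ⟨
    2 * (n C k) + s * Δ + s * suc k                     ∎)
    where
    open ≤-Reasoning
    s = length S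
    Δ = maxDegree (suc k) S
    ∑∣A∣Ck≡∣S∣*[1+k] : ∑[ A ∈ S ] (∣ A ∣ C k) ≡ s * suc k
    ∑∣A∣Ck≡∣S∣*[1+k] = trans (∑-cong-local (All.map (λ e → trans (cong (_C k) e) ([1+n]Cn≡1+n k)) sizes))
                             (∑-const (suc k) S)
    ∑degree≤∣S∣*Δ : ∑ S (degree (suc k) S) ≤ s * Δ
    ∑degree≤∣S∣*Δ = subst (λ l → ∑ S (degree (suc k) S) ≤ l * Δ) (length-map (degree (suc k) S) S)
                          (sum≤length*max (map (degree (suc k) S) S))
    ∑∑∣A∩B∣Ck≤∣S∣*Δ+∣S∣*[1+k] : ∑[ A ∈ S ] ∑[ B ∈ S ] (∣ A ∩ B ∣ C k) ≤ s * Δ + s * suc k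
    ∑∑∣A∩B∣Ck≤∣S∣*Δ+∣S∣*[1+k] = begin
      ∑[ A ∈ S ] ∑[ B ∈ S ] (∣ A ∩ B ∣ C k)   ≤⟨ ∑-mono-≤-local (All.map (λ {A} → ∑∣A∩B∣Ck≤degree+1+k {A}) sizes) ⟩
      ∑[ A ∈ S ] (degree (suc k) S A + suc k) ≡⟨ ∑-distrib-+ S ⟩
      ∑ S (degree (suc k) S) + ∑[ _ ∈ S ] suc k ≤⟨ +-mono-≤ ∑degree≤∣S∣*Δ (≤-reflexive (∑-const (suc k) S)) ⟩
      s * Δ + s * suc k                       ∎

d≤maxDegree : ∀ {n d} → 1 ≤ d → d < n → (S : List (Subset n)) → Unique S → All (λ A → ∣ A ∣ ≡ d) S →
  length S ≡ (n ∸ 1) C (d ∸ 1) + 1 → d ≤ maxDegree d S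
d≤maxDegree {suc m} {suc k} _ (s≤s k<m) S unique sizes ∣S∣≡mCk+1 =
  ≮⇒≥ (λ Δ<1+k → <⇒≱ (2*[1+n]Ck<[nCk+1]*[2+k] k<m) (Δ≤k⇒[mCk+1]*[2+k]≤2*[1+m]Ck (s≤s⁻¹ Δ<1+k)))
  where
  open ≤-Reasoning
  s = length S
  Δ = maxDegree (suc k) S
  regroup : ∀ s k → s * (2 + k) + s * k ≡ 2 * (s * suc k)
  regroup = solve-∀
  Δ≤k⇒[mCk+1]*[2+k]≤2*[1+m]Ck : Δ ≤ k → (m C k + 1) * (2 + k) ≤ 2 * (suc m C k)
  Δ≤k⇒[mCk+1]*[2+k]≤2*[1+m]Ck Δ≤k = subst (λ s → s * (2 + k) ≤ 2 * (suc m C k)) ∣S∣≡mCk+1 (+-cancelʳ-≤ (s * k) _ _ (begin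
    s * (2 + k) + s * k      ≡⟨ regroup s k ⟩
    2 * (s * suc k)          ≤⟨ 2*∣S∣*[1+k]≤2*nCk+∣S∣*maxDegree k unique sizes ⟩
    2 * (suc m C k) + s * Δ  ≤⟨ +-monoʳ-≤ (2 * (suc m C k)) (*-monoʳ-≤ s Δ≤k) ⟩
    2 * (suc m C k) + s * k  ∎))

∣∁p∩∁q∣+[∣p∣+∣q∣]≡n+∣p∩q∣ : ∀ {n} (p q : Subset n) → ∣ ∁ p ∩ ∁ q ∣ + (∣ p ∣ + ∣ q ∣) ≡ n + ∣ p ∩ q ∣
∣∁p∩∁q∣+[∣p∣+∣q∣]≡n+∣p∩q∣ []          []          = refl
∣∁p∩∁q∣+[∣p∣+∣q∣]≡n+∣p∩q∣ {suc n} (true ∷ p) (true ∷ q) = begin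
  ∣ ∁ p ∩ ∁ q ∣ + suc (∣ p ∣ + suc ∣ q ∣)    ≡⟨ +-suc _ _ ⟩
  suc (∣ ∁ p ∩ ∁ q ∣ + (∣ p ∣ + suc ∣ q ∣))  ≡⟨ cong (λ z → suc (∣ ∁ p ∩ ∁ q ∣ + z)) (+-suc ∣ p ∣ ∣ q ∣) ⟩
  suc (∣ ∁ p ∩ ∁ q ∣ + suc (∣ p ∣ + ∣ q ∣))  ≡⟨ cong suc (+-suc _ _) ⟩
  suc (suc (∣ ∁ p ∩ ∁ q ∣ + (∣ p ∣ + ∣ q ∣))) ≡⟨ cong (suc ∘ suc) (∣∁p∩∁q∣+[∣p∣+∣q∣]≡n+∣p∩q∣ p q) ⟩
  suc (suc (n + ∣ p ∩ q ∣))                  ≡⟨ cong suc (+-suc n _) ⟨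
  suc (n + suc ∣ p ∩ q ∣)                    ∎
  where open ≡-Reasoning
∣∁p∩∁q∣+[∣p∣+∣q∣]≡n+∣p∩q∣ (true ∷ p)  (false ∷ q) = begin
  ∣ ∁ p ∩ ∁ q ∣ + suc (∣ p ∣ + ∣ q ∣)        ≡⟨ +-suc _ _ ⟩
  suc (∣ ∁ p ∩ ∁ q ∣ + (∣ p ∣ + ∣ q ∣))      ≡⟨ cong suc (∣∁p∩∁q∣+[∣p∣+∣q∣]≡n+∣p∩q∣ p q) ⟩
  suc (_ + ∣ p ∩ q ∣)                        ∎
  where open ≡-Reasoning
∣∁p∩∁q∣+[∣p∣+∣q∣]≡n+∣p∩q∣ (false ∷ p) (true ∷ q)  = begin
  ∣ ∁ p ∩ ∁ q ∣ + (∣ p ∣ + suc ∣ q ∣)        ≡⟨ cong (∣ ∁ p ∩ ∁ q ∣ +_) (+-suc ∣ p ∣ ∣ q ∣) ⟩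
  ∣ ∁ p ∩ ∁ q ∣ + suc (∣ p ∣ + ∣ q ∣)        ≡⟨ +-suc _ _ ⟩
  suc (∣ ∁ p ∩ ∁ q ∣ + (∣ p ∣ + ∣ q ∣))      ≡⟨ cong suc (∣∁p∩∁q∣+[∣p∣+∣q∣]≡n+∣p∩q∣ p q) ⟩
  suc (_ + ∣ p ∩ q ∣)                        ∎
  where open ≡-Reasoning
∣∁p∩∁q∣+[∣p∣+∣q∣]≡n+∣p∩q∣ (false ∷ p) (false ∷ q) = cong suc (∣∁p∩∁q∣+[∣p∣+∣q∣]≡n+∣p∩q∣ p q)

∁-injective : ∀ {n} {p q : Subset n} → ∁ p ≡ ∁ q → p ≡ q
∁-injective ∁p≡∁q = ⊆-antisym (∁p⊆∁q⇒p⊇q (⊆-reflexive (sym ∁p≡∁q))) (∁p⊆∁q⇒p⊇q (⊆-reflexive ∁p≡∁q))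

y+a≡b+x⇒x≡a∸1⇔y≡b∸1 : ∀ {x y a b} → 1 ≤ a → 1 ≤ b → y + a ≡ b + x → (x ≡ a ∸ 1 ⇔ y ≡ b ∸ 1)
y+a≡b+x⇒x≡a∸1⇔y≡b∸1 {x} {y} {suc a} {suc b} (s≤s z≤n) (s≤s z≤n) y+1+a≡1+b+x = mk⇔ to from
  where
  to : x ≡ a → y ≡ b
  to refl = +-cancelʳ-≡ (suc x) y b (trans y+1+a≡1+b+x (sym (+-suc b x)))
  from : y ≡ b → x ≡ a
  from refl = sym (suc-injective (+-cancelˡ-≡ y (suc a) (suc x) (trans y+1+a≡1+b+x (sym (+-suc y x)))))

module _ {n d} (1≤d : 1 ≤ d) (d<n : d < n) where

  ∁-preserves-adjacency : ∀ {A B : Subset n} → ∣ A ∣ ≡ d → ∣ B ∣ ≡ d →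
                          JohnsonAdj d A B ⇔ JohnsonAdj (n ∸ d) (∁ A) (∁ B)
  ∁-preserves-adjacency {A} {B} ∣A∣≡d ∣B∣≡d =
    y+a≡b+x⇒x≡a∸1⇔y≡b∸1 1≤d (m<n⇒0<n∸m d<n) (+-cancelʳ-≡ d _ _ (begin
      ∣ ∁ A ∩ ∁ B ∣ + d + d          ≡⟨ +-assoc ∣ ∁ A ∩ ∁ B ∣ d d ⟩
      ∣ ∁ A ∩ ∁ B ∣ + (d + d)        ≡⟨ cong₂ (λ a b → ∣ ∁ A ∩ ∁ B ∣ + (a + b)) ∣A∣≡d ∣B∣≡d ⟨
      ∣ ∁ A ∩ ∁ B ∣ + (∣ A ∣ + ∣ B ∣) ≡⟨ ∣∁p∩∁q∣+[∣p∣+∣q∣]≡n+∣p∩q∣ A B ⟩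
      n + ∣ A ∩ B ∣                  ≡⟨ cong (_+ ∣ A ∩ B ∣) (m+[n∸m]≡n (<⇒≤ d<n)) ⟨
      d + (n ∸ d) + ∣ A ∩ B ∣        ≡⟨ +-assoc d (n ∸ d) ∣ A ∩ B ∣ ⟩
      d + (n ∸ d + ∣ A ∩ B ∣)        ≡⟨ +-comm d (n ∸ d + ∣ A ∩ B ∣) ⟩
      n ∸ d + ∣ A ∩ B ∣ + d          ∎))
    where open ≡-Reasoning

  module _ {S : List (Subset n)} (sizes : All (λ A → ∣ A ∣ ≡ d) S) where

    degree-∁ : ∀ {A} → ∣ A ∣ ≡ d → degree (n ∸ d) (map ∁ S) (∁ A) ≡ degree d S A
    degree-∁ {A} ∣A∣≡d = begin
      degree (n ∸ d) (map ∁ S) (∁ A)                     ≡⟨ ∑𝟙≡length-filter (johnsonAdj? (n ∸ d) (∁ A)) (map ∁ S) ⟨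
      ∑[ B ∈ map ∁ S ] 𝟙 (johnsonAdj? (n ∸ d) (∁ A) B)   ≡⟨ ∑-map _ ∁ S ⟩
      ∑[ B ∈ S ] 𝟙 (johnsonAdj? (n ∸ d) (∁ A) (∁ B))     ≡⟨ ∑-cong-local (All.map adjacency-∁ sizes) ⟨
      ∑[ B ∈ S ] 𝟙 (johnsonAdj? d A B)                   ≡⟨ ∑𝟙≡length-filter (johnsonAdj? d A) S ⟩
      degree d S A                                       ∎
      where
      open ≡-Reasoning
      adjacency-∁ : ∀ {B} → ∣ B ∣ ≡ d → 𝟙 (johnsonAdj? d A B) ≡ 𝟙 (johnsonAdj? (n ∸ d) (∁ A) (∁ B))
      adjacency-∁ {B} ∣B∣≡d = 𝟙-cong (∁-preserves-adjacency {A} {B} ∣A∣≡d ∣B∣≡d) (johnsonAdj? d A B) (johnsonAdj? (n ∸ d) (∁ A) (∁ B))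

    maxDegree-∁ : maxDegree (n ∸ d) (map ∁ S) ≡ maxDegree d S
    maxDegree-∁ = cong (foldr _⊔_ 0) (trans (sym (map-∘ S)) (map-cong-local (All.map (λ {A} → degree-∁ {A}) sizes)))

[n∸1]Cd≡[n∸1]C[n∸d∸1] : ∀ {n d} → d < n → (n ∸ 1) C d ≡ (n ∸ 1) C (n ∸ d ∸ 1)
[n∸1]Cd≡[n∸1]C[n∸d∸1] {suc m} {d} (s≤s d≤m) = trans (nCk≡nC[n∸k] d≤m)
  (cong (m C_) (trans (cong (suc m ∸_) (+-comm 1 d)) (sym (∸-+-assoc (suc m) d 1))))

n∸d≤maxDegree : ∀ {n d} → 1 ≤ d → d < n → (S : List (Subset n)) → Unique S → All (λ A → ∣ A ∣ ≡ d) S →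
  length S ≡ (n ∸ 1) C d + 1 → n ∸ d ≤ maxDegree d S
n∸d≤maxDegree {n} {d} 1≤d d<n S unique sizes ∣S∣≡[n∸1]Cd+1 = subst (n ∸ d ≤_) (maxDegree-∁ 1≤d d<n sizes)
  (d≤maxDegree (m<n⇒0<n∸m d<n) (∸-monoʳ-< 1≤d (<⇒≤ d<n)) (map ∁ S) (Unique.map⁺ ∁-injective unique) ∁-sizes ∣∁S∣≡[n∸1]C[n∸d∸1]+1)
  where
  ∁-sizes : All (λ A → ∣ A ∣ ≡ n ∸ d) (map ∁ S)
  ∁-sizes = All.map⁺ (All.map (λ {A} ∣A∣≡d → trans (∣∁p∣≡n∸∣p∣ A) (cong (n ∸_) ∣A∣≡d)) sizes)
  ∣∁S∣≡[n∸1]C[n∸d∸1]+1 : length (map ∁ S) ≡ (n ∸ 1) C (n ∸ d ∸ 1) + 1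
  ∣∁S∣≡[n∸1]C[n∸d∸1]+1 = trans (length-map ∁ S) (trans ∣S∣≡[n∸1]Cd+1 (cong (_+ 1) ([n∸1]Cd≡[n∸1]C[n∸d∸1] d<n)))

proposition5p15 : (n d r : ℕ) → 1 ≤ d → 2 * d ≤ n →
    (S : List (Subset n)) → Unique S → All (λ A → ∣ A ∣ ≡ d) S → length S ≡ r →
    ((r ≡ ((n ∸ 1) C d) + 1 → n ∸ d ≤ maxDegree d S) ×
     (r ≡ ((n ∸ 1) C (d ∸ 1)) + 1 → d ≤ maxDegree d S))
proposition5p15 n d r 1≤d 2d≤n S unique sizes ∣S∣≡r =
    (λ r≡ → n∸d≤maxDegree 1≤d d<n S unique sizes (trans ∣S∣≡r r≡))
  , (λ r≡ → d≤maxDegree   1≤d d<n S unique sizes (trans ∣S∣≡r r≡))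
  where
  d<n : d < n
  d<n = ≤-trans (m<m+n d 1≤d) (subst (_≤ n) (cong (d +_) (+-identityʳ d)) 2d≤n)
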